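{- Let $G=H_{n,p}$ and suppose $G$ is $S$-magic for a set $S$, with $\theta(G)=1$ and $S$-magic constant $\frac{n^2p+n+1}{2}(p-1)$. Then there exists a set $S'$ such that $G$ is $S'$-magic with $\theta(G)=1$ and $S'$-magic constant $\frac{n^2p+3n-1}{2}(p-1)$.
   Context: $H_{n,p}$ denotes the complete multipartite graph with $p$ parts each having exactly $n$ vertices. For a finite set $S$ of positive integers with $|S|=|V(G)|$, a graph $G$ is $S$-magic if there is a bijection $f:V(G)\to S$ and a constant $c$ (the $S$-magic constant) with $\sum_{v\in N(u)} f(v)=c$ for every vertex $u$, where $N(u)$ is the set of neighbours of $u$. Let $\alpha(S)=\max S$ and $i(G)=\min \alpha(S)$ over all $S$ for which $G$ is $S$-magic; the distance magic index is $\theta(G)=i(G)-|V(G)|$. When $\theta(G)=1$, the relevant sets are of the form $S=\{1,\dots,|V(G)|+1\}\setminus\{a\}$ with $a\in\{1,\dots,|V(G)|\}$. -}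

module Defs where

open import Data.Nat using (ℕ; zero; suc; _+_; _*_; _∸_; _≤_; _<_)
open import Data.Fin using (Fin; _≟_)
open import Data.Product using (Σ; ∃; _×_; _,_)
open import Data.Bool using (if_then_else_)
open import Relation.Nullary using (¬_)
open import Relation.Nullary.Decidable using (⌊_⌋)
open import Relation.Binary.PropositionalEquality using (_≡_)
open import Function.Definitions using (Injective)

Σℕ : (k : ℕ) → (Fin k → ℕ) → ℕ
Σℕ zero    g = 0
Σℕ (suc k) g = g Fin.zero + Σℕ k (λ i → g (Fin.suc i))

-- Vertices of H_{n,p}: pairs (part i : Fin p, index j : Fin n).
-- Two vertices are adjacent iff they lie in different parts.
Vertex : ℕ → ℕ → Set
Vertex n p = Fin p × Fin n

nbrSum : (n p : ℕ) → (Vertex n p → ℕ) → Vertex n p → ℕ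
nbrSum n p f (i₀ , _) =
  Σℕ p (λ i → if ⌊ i ≟ i₀ ⌋ then 0 else Σℕ n (λ j → f (i , j)))

-- f is a bijection from V(H_{n,p}) onto its image S ⊆ ℤ⁺ (S = image of f),
-- and H_{n,p} is S-magic with S-magic constant c via f.
IsMagicLabelling : (n p : ℕ) → (Vertex n p → ℕ) → ℕ → Set
IsMagicLabelling n p f c =
  Injective _≡_ _≡_ f
  × (∀ v → 1 ≤ f v)
  × (∀ u → nbrSum n p f u ≡ c)

MaxLabel : (n p : ℕ) → (Vertex n p → ℕ) → ℕ → Set
MaxLabel n p f m = (∀ v → f v ≤ m) × (∃ λ v → f v ≡ m)

MagicWithMax : (n p m : ℕ) → Set
MagicWithMax n p m =
  Σ (Vertex n p → ℕ) λ f → ∃ λ c → IsMagicLabelling n p f c × MaxLabel n p f m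

IndexIs : (n p m : ℕ) → Set
IndexIs n p m = MagicWithMax n p m × (∀ k → k < m → ¬ MagicWithMax n p k)

-- θ(H_{n,p}) = 1, i.e. i(H_{n,p}) = |V| + 1 = n p + 1
ThetaIsOne : (n p : ℕ) → Set
ThetaIsOne n p = IndexIs n p (n * p + 1)

-- Reflecting the labels, v ↦ (np + 2) − f v, keeps a labelling of H_{n,p} magic, since
-- every neighbourhood sum of f and of its reflection add up to the same number
-- (p − 1) n (np + 2). The reflection has maximum np + 1 exactly when f attains the label 1,
-- and it does: otherwise f − 1 would be a magic labelling with maximum np, against θ = 1.
-- The new constant is (p − 1) n (np + 2) − c.
module Submission where

open import Defs
open import Data.Nat using (ℕ; zero; suc; _+_; _*_; _∸_; _≤_; _<_; z≤n; s≤s)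
open import Data.Nat.Properties renaming (_≟_ to _≟ℕ_)
open import Data.Nat.Tactic.RingSolver using (solve-∀)
open import Data.Fin using (Fin; _≟_)
import Data.Fin as Fin
open import Data.Fin.Properties using (any?)
open import Data.Product using (Σ; ∃; _×_; _,_; proj₂)
open import Data.Bool using (true; false; if_then_else_)
open import Data.Empty using (⊥-elim)
open import Relation.Nullary using (¬_; Dec; yes; no)
open import Relation.Nullary.Decidable using (⌊_⌋; map′)
open import Relation.Binary.PropositionalEquality
open import Algebra.Properties.CommutativeSemigroup +-commutativeSemigroup using (interchange)

Σℕ-cong : ∀ k {a b : Fin k → ℕ} → (∀ i → a i ≡ b i) → Σℕ k a ≡ Σℕ k b
Σℕ-cong zero    h = refl
Σℕ-cong (suc k) h = cong₂ _+_ (h Fin.zero) (Σℕ-cong k (λ i → h (Fin.suc i)))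

Σℕ-+ : ∀ k (a b : Fin k → ℕ) → Σℕ k a + Σℕ k b ≡ Σℕ k (λ i → a i + b i)
Σℕ-+ zero    a b = refl
Σℕ-+ (suc k) a b =
  trans (interchange (a Fin.zero) _ (b Fin.zero) _)
        (cong (a Fin.zero + b Fin.zero +_) (Σℕ-+ k _ _))

Σℕ-const : ∀ k m → Σℕ k (λ _ → m) ≡ k * m
Σℕ-const zero    m = refl
Σℕ-const (suc k) m = cong (m +_) (Σℕ-const k m)

Σℕ-omit-one : ∀ p m (i₀ : Fin p) → Σℕ p (λ i → if ⌊ i ≟ i₀ ⌋ then 0 else m) ≡ (p ∸ 1) * m
Σℕ-omit-one (suc q) m Fin.zero    = Σℕ-const q m
Σℕ-omit-one (suc (suc q)) m (Fin.suc j) =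
  cong (m +_) (trans (Σℕ-cong (suc q) skip-suc) (Σℕ-omit-one (suc q) m j))
  where
  skip-suc : ∀ i → (if ⌊ Fin.suc i ≟ Fin.suc j ⌋ then 0 else m) ≡ (if ⌊ i ≟ j ⌋ then 0 else m)
  skip-suc i with i ≟ j
  ... | yes _ = refl
  ... | no _  = refl

nbrSum-+ : ∀ n p (a b d : Vertex n p → ℕ) → (∀ v → a v + b v ≡ d v) →
           ∀ u → nbrSum n p a u + nbrSum n p b u ≡ nbrSum n p d u
nbrSum-+ n p a b d h (i₀ , _) = trans (Σℕ-+ p _ _) (Σℕ-cong p partSum)
  where
  partSum : ∀ i → (if ⌊ i ≟ i₀ ⌋ then 0 else Σℕ n (λ j → a (i , j)))
                + (if ⌊ i ≟ i₀ ⌋ then 0 else Σℕ n (λ j → b (i , j)))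
                ≡ (if ⌊ i ≟ i₀ ⌋ then 0 else Σℕ n (λ j → d (i , j)))
  partSum i with ⌊ i ≟ i₀ ⌋
  ... | true  = refl
  ... | false = trans (Σℕ-+ n _ _) (Σℕ-cong n (λ j → h (i , j)))

nbrSum-const : ∀ n p k (u : Vertex n p) → nbrSum n p (λ _ → k) u ≡ (p ∸ 1) * (n * k)
nbrSum-const n p k (i₀ , _) =
  trans (Σℕ-omit-one p _ i₀) (cong ((p ∸ 1) *_) (Σℕ-const n k))

m+n≡o⇒m≡o∸n : ∀ m n {o} → m + n ≡ o → m ≡ o ∸ n
m+n≡o⇒m≡o∸n m n e = trans (sym (m+n∸n≡m m n)) (cong (_∸ n) e)

module _ {n p : ℕ} {f : Vertex n p → ℕ} where

  reflect : ℕ → Vertex n p → ℕ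
  reflect t v = suc t ∸ f v

  reflect-nbrSum : ∀ t → (∀ v → f v ≤ t) →
                   ∀ u → nbrSum n p (reflect t) u + nbrSum n p f u ≡ (p ∸ 1) * (n * suc t)
  reflect-nbrSum t bnd u =
    trans (nbrSum-+ n p _ f _ (λ v → m∸n+n≡m (m≤n⇒m≤1+n (bnd v))) u) (nbrSum-const n p (suc t) u)

  reflect-isMagic : ∀ {c t} → IsMagicLabelling n p f c → (∀ v → f v ≤ t) →
                    IsMagicLabelling n p (reflect t) ((p ∸ 1) * (n * suc t) ∸ c)
  reflect-isMagic {c} {t} (inj , _ , magic) bnd = inj′ , pos′ , magic′
    where
    inj′ : ∀ {x y} → reflect t x ≡ reflect t y → x ≡ y
    inj′ {x} {y} e = inj (∸-cancelˡ-≡ (m≤n⇒m≤1+n (bnd x)) (m≤n⇒m≤1+n (bnd y)) e)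
    pos′ : ∀ v → 1 ≤ reflect t v
    pos′ v = m<n⇒0<n∸m (s≤s (bnd v))
    magic′ : ∀ u → nbrSum n p (reflect t) u ≡ (p ∸ 1) * (n * suc t) ∸ c
    magic′ u = m+n≡o⇒m≡o∸n _ c (trans (cong (_ +_) (sym (magic u))) (reflect-nbrSum t bnd u))

  reflect-maxLabel : ∀ t → (∀ v → 1 ≤ f v) → (∃ λ v → f v ≡ 1) → MaxLabel n p (reflect t) t
  reflect-maxLabel t pos (v₁ , f≡1) = (λ v → ∸-monoʳ-≤ (suc t) (pos v)) , (v₁ , cong (suc t ∸_) f≡1)

  lower : Vertex n p → ℕ
  lower v = f v ∸ 1

  lower-isMagic : ∀ {c} → IsMagicLabelling n p f c → (∀ v → 2 ≤ f v) →
                  IsMagicLabelling n p lower (c ∸ (p ∸ 1) * (n * 1))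
  lower-isMagic {c} (inj , pos , magic) ge2 = inj′ , (λ v → ∸-monoˡ-≤ 1 (ge2 v)) , magic′
    where
    inj′ : ∀ {x y} → lower x ≡ lower y → x ≡ y
    inj′ {x} {y} e = inj (∸-cancelʳ-≡ (pos x) (pos y) e)
    magic′ : ∀ u → nbrSum n p lower u ≡ c ∸ (p ∸ 1) * (n * 1)
    magic′ u = m+n≡o⇒m≡o∸n (nbrSum n p lower u) _
      (trans (cong (nbrSum n p lower u +_) (sym (nbrSum-const n p 1 u)))
             (trans (nbrSum-+ n p lower _ f (λ v → m∸n+n≡m (pos v)) u) (magic u)))

  lower-maxLabel : ∀ {m} → MaxLabel n p f m → MaxLabel n p lower (m ∸ 1)
  lower-maxLabel (bnd , (v , f≡m)) = (λ w → ∸-monoˡ-≤ 1 (bnd w)) , (v , cong (_∸ 1) f≡m)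

  label-one? : Dec (∃ λ v → f v ≡ 1)
  label-one? = map′ (λ { (i , j , e) → (i , j) , e }) (λ { ((i , j) , e) → i , j , e })
                    (any? λ i → any? λ j → f (i , j) ≟ℕ 1)

  minimal⇒label-one : ∀ {c m} → (∀ k → k < m → ¬ MagicWithMax n p k) →
                      IsMagicLabelling n p f c → MaxLabel n p f m → ∃ λ v → f v ≡ 1
  minimal⇒label-one {m = m} minimal magic@(_ , pos , _) max@(_ , (v₀ , f≡m)) with label-one?
  ... | yes one = one
  ... | no ¬one = ⊥-elim (minimal (m ∸ 1) lower<m (lower , _ , lower-isMagic magic ge2 , lower-maxLabel max))
    where
    ge2 : ∀ v → 2 ≤ f v
    ge2 v = ≤∧≢⇒< (pos v) (λ 1≡f → ¬one (v , sym 1≡f))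
    lower<m : m ∸ 1 < m
    lower<m = ∸-monoʳ-< {o = 0} ≤-refl (subst (1 ≤_) f≡m (pos v₀))

reflected-constant : ∀ a b k q {c c′} → 2 * k ≡ a + b → c′ + c ≡ q * k → 2 * c ≡ a * q → 2 * c′ ≡ b * q
reflected-constant a b k q {c} {c′} split sum twice-c = +-cancelʳ-≡ (2 * c) _ _ (begin
  2 * c′ + 2 * c  ≡⟨ sym (*-distribˡ-+ 2 c′ c) ⟩
  2 * (c′ + c)    ≡⟨ cong (2 *_) (trans sum (*-comm q k)) ⟩
  2 * (k * q)     ≡⟨ sym (*-assoc 2 k q) ⟩
  2 * k * q       ≡⟨ cong (_* q) (trans split (+-comm a b)) ⟩
  (b + a) * q     ≡⟨ *-distribʳ-+ q b a ⟩
  b * q + a * q   ≡⟨ cong (b * q +_) (sym twice-c) ⟩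
  b * q + 2 * c   ∎)
  where open ≡-Reasoning

double-reflection-sum : ∀ m p →
  2 * (suc m * suc (suc m * p + 1))
    ≡ (suc m * suc m * p + suc m + 1) + (suc m * suc m * p + 3 * suc m ∸ 1)
double-reflection-sum m p rewrite +-∸-assoc (suc m * suc m * p) {3 * suc m} {1} (s≤s z≤n) = identity m p
  where
  -- 3 * suc m ∸ 1 computes to m + (suc m + (suc m + 0)), which the ring solver can handle
  identity : ∀ m p → 2 * (suc m * suc (suc m * p + 1))
                     ≡ (suc m * suc m * p + suc m + 1) + (suc m * suc m * p + (m + (suc m + (suc m + 0))))
  identity = solve-∀

theorem12 : (n p : ℕ) → ThetaIsOne n p →
    (f : Vertex n p → ℕ) → (c : ℕ) →
    IsMagicLabelling n p f c → MaxLabel n p f (n * p + 1) →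
    2 * c ≡ (n * n * p + n + 1) * (p ∸ 1) →
    Σ (Vertex n p → ℕ) λ f′ → ∃ λ c′ →
      IsMagicLabelling n p f′ c′ × MaxLabel n p f′ (n * p + 1)
      × 2 * c′ ≡ (n * n * p + 3 * n ∸ 1) * (p ∸ 1)
theorem12 zero _ _ _ _ _ (_ , ((_ , ()) , _)) _
theorem12 n@(suc m) p (_ , minimal) f c magic@(_ , pos , nbr) max@(bnd , (v₀ , _)) twice-c =
  f′ , c′ , magic′ , reflect-maxLabel t pos (minimal⇒label-one minimal magic max) ,
  reflected-constant (n * n * p + n + 1) (n * n * p + 3 * n ∸ 1) (n * suc t) (p ∸ 1) {c} {c′}
    (double-reflection-sum m p) constants-sum twice-c
  where
  t : ℕ
  t = n * p + 1
  f′ : Vertex n p → ℕ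
  f′ = reflect {f = f} t
  c′ : ℕ
  c′ = (p ∸ 1) * (n * suc t) ∸ c
  magic′ : IsMagicLabelling n p f′ c′
  magic′ = reflect-isMagic magic bnd
  constants-sum : c′ + c ≡ (p ∸ 1) * (n * suc t)
  constants-sum = trans (cong₂ _+_ (sym (proj₂ (proj₂ magic′) v₀)) (sym (nbr v₀))) (reflect-nbrSum t bnd v₀)
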